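{- For every algebraic signature $\Sigma$, the category $\mathbf{Hyp}_\Sigma$ is adhesive. Moreover, a morphism $(h,k)$ between two objects of $\mathbf{Hyp}_\Sigma$ is a monomorphism if and only if $h$ and $k$ are injective functions.
   Context: For a set $X$, $X^\star$ is the set of finite words over $X$, and $k^\star$ applies $k$ letterwise. A hypergraph is $\mathcal{G}=(E_{\mathcal{G}},V_{\mathcal{G}},s_{\mathcal{G}},t_{\mathcal{G}})$ with sets of hyperedges and nodes and functions $s_{\mathcal{G}},t_{\mathcal{G}}:E_{\mathcal{G}}\to V_{\mathcal{G}}^\star$; a morphism $(h,k):\mathcal{G}\to\mathcal{H}$ is a pair of functions $h:E_{\mathcal{G}}\to E_{\mathcal{H}}$, $k:V_{\mathcal{G}}\to V_{\mathcal{H}}$ with $s_{\mathcal{H}}h=k^\star s_{\mathcal{G}}$, $t_{\mathcal{H}}h=k^\star t_{\mathcal{G}}$; this is the category $\mathbf{Hyp}$. An algebraic signature is $\Sigma=(O,\mathrm{ar})$ with $O$ a set and $\mathrm{ar}:O\to\mathbb{N}$. The hypergraph $\mathcal{G}^\Sigma$ has node set $\{v\}$, hyperedge set $O$, $s(o)=v^{\mathrm{ar}(o)}$ and $t(o)=v$. $\mathbf{Hyp}_\Sigma$ is the slice category $\mathbf{Hyp}/\mathcal{G}^\Sigma$; a morphism of $\mathbf{Hyp}_\Sigma$ is given by a morphism $(h,k)$ of $\mathbf{Hyp}$ commuting with the maps to $\mathcal{G}^\Sigma$. A category is adhesive if pullbacks along monomorphisms exist, pushouts along monomorphisms exist, and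 such pushouts are Van Kampen squares: for every commutative cube having the pushout as bottom face and whose two vertical faces containing the vertical arrow over the apex of the span are pullbacks, the top face is a pushout iff the other two vertical faces are pullbacks. -}

module Defs where

open import Level using (0ℓ)
open import Data.Nat using (ℕ)
open import Data.Unit using (⊤; tt)
open import Data.List using (List; []; _∷_; map; replicate; [_])
open import Data.List.Properties using (map-∘)
import Data.List.Relation.Binary.Pointwise as PW
open PW using (Pointwise; []; _∷_)
open import Data.Product using (Σ; Σ-syntax; _×_; _,_; proj₁; proj₂)
open import Function.Bundles using (Func; _⇔_)
open import Function.Definitions using (Injective)
open import Relation.Binary.Bundles using (Setoid)
open import Relation.Binary.PropositionalEquality as ≡ using (_≡_; refl)

open Func using (to)

record Category : Set₂ where
  infix  4 _≈_
  infixr 9 _∘_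
  field
    Obj : Set₁
    Hom : Obj → Obj → Set
    _≈_ : ∀ {A B} → Hom A B → Hom A B → Set
    _∘_ : ∀ {A B C} → Hom B C → Hom A B → Hom A C

module _ (𝒞 : Category) where
  open Category 𝒞

  Mono : ∀ {A B} → Hom A B → Set₁
  Mono {A} f = ∀ {X} (g₁ g₂ : Hom X A) → f ∘ g₁ ≈ f ∘ g₂ → g₁ ≈ g₂

  IsPullback : ∀ {P A B C} → Hom P A → Hom P B → Hom A C → Hom B C → Set₁
  IsPullback {P} {A} {B} p₁ p₂ f g =
    (f ∘ p₁ ≈ g ∘ p₂) ×
    (∀ {X} (q₁ : Hom X A) (q₂ : Hom X B) → f ∘ q₁ ≈ g ∘ q₂ →
       Σ[ u ∈ Hom X P ] ((p₁ ∘ u ≈ q₁) × (p₂ ∘ u ≈ q₂) ×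
         (∀ (u' : Hom X P) → p₁ ∘ u' ≈ q₁ → p₂ ∘ u' ≈ q₂ → u' ≈ u)))

  IsPushout : ∀ {A B C D} → Hom A D → Hom B D → Hom C A → Hom C B → Set₁
  IsPushout {A} {B} {C} {D} i₁ i₂ m f =
    (i₁ ∘ m ≈ i₂ ∘ f) ×
    (∀ {X} (j₁ : Hom A X) (j₂ : Hom B X) → j₁ ∘ m ≈ j₂ ∘ f →
       Σ[ u ∈ Hom D X ] ((u ∘ i₁ ≈ j₁) × (u ∘ i₂ ≈ j₂) ×
         (∀ (u' : Hom D X) → u' ∘ i₁ ≈ j₁ → u' ∘ i₂ ≈ j₂ → u' ≈ u)))

  -- For every commutative cube over it (top face m', f', i₁', i₂';
  -- vertical arrows a, b, c, d) whose two vertical faces containing c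
  -- (the vertical arrow over the apex C of the span) are pullbacks,
  -- the top face is a pushout iff the two other vertical faces are pullbacks.
  IsVanKampen : ∀ {A B C D} → Hom A D → Hom B D → Hom C A → Hom C B → Set₁
  IsVanKampen {A} {B} {C} {D} i₁ i₂ m f =
    ∀ {A' B' C' D'}
      (m' : Hom C' A') (f' : Hom C' B') (i₁' : Hom A' D') (i₂' : Hom B' D')
      (a : Hom A' A) (b : Hom B' B) (c : Hom C' C) (d : Hom D' D) →
    i₁' ∘ m' ≈ i₂' ∘ f' →
    i₁ ∘ a ≈ d ∘ i₁' →
    i₂ ∘ b ≈ d ∘ i₂' →
    IsPullback m' c a m →
    IsPullback f' c b f →
    IsPushout i₁' i₂' m' f' ⇔ (IsPullback i₁' a d i₁ × IsPullback i₂' b d i₂)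

  record Adhesive : Set₂ where
    field
      pullback-along-mono :
        ∀ {A B C} (f : Hom A C) (m : Hom B C) → Mono m →
        Σ[ P ∈ Obj ] Σ[ p₁ ∈ Hom P A ] Σ[ p₂ ∈ Hom P B ] IsPullback p₁ p₂ f m
      pushout-along-mono :
        ∀ {A B C} (m : Hom C A) (f : Hom C B) → Mono m →
        Σ[ D ∈ Obj ] Σ[ i₁ ∈ Hom A D ] Σ[ i₂ ∈ Hom B D ] IsPushout i₁ i₂ m f
      pushout-along-mono-isVanKampen :
        ∀ {A B C D} (m : Hom C A) (f : Hom C B) (i₁ : Hom A D) (i₂ : Hom B D) →
        Mono m → IsPushout i₁ i₂ m f → IsVanKampen i₁ i₂ m f

-- Hypergraphs.  "Sets" are rendered as setoids (Bishop sets), since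
-- pushouts (quotients) of bare Agda types do not exist constructively.
-- Words X⋆ are lists, with pointwise equality.

Word : Setoid 0ℓ 0ℓ → Setoid 0ℓ 0ℓ
Word X = PW.setoid X

record Hypergraph : Set₁ where
  field
    E : Setoid 0ℓ 0ℓ
    V : Setoid 0ℓ 0ℓ
    s : Func E (Word V)
    t : Func E (Word V)
open Hypergraph public

record HypMor (G H : Hypergraph) : Set where
  field
    h : Func (E G) (E H)
    k : Func (V G) (V H)
    s-comm : ∀ e → Setoid._≈_ (Word (V H)) (to (s H) (to h e)) (map (to k) (to (s G) e))
    t-comm : ∀ e → Setoid._≈_ (Word (V H)) (to (t H) (to h e)) (map (to k) (to (t G) e))
open HypMor public

_≈Hyp_ : ∀ {G H} → HypMor G H → HypMor G H → Set
_≈Hyp_ {G} {H} f g =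
  (∀ e → Setoid._≈_ (E H) (to (h f) e) (to (h g) e)) ×
  (∀ v → Setoid._≈_ (V H) (to (k f) v) (to (k g) v))

private
  map-cong : ∀ {X Y : Setoid 0ℓ 0ℓ} (f : Func X Y) {xs ys} →
             Pointwise (Setoid._≈_ X) xs ys →
             Pointwise (Setoid._≈_ Y) (map (to f) xs) (map (to f) ys)
  map-cong f [] = []
  map-cong f (p ∷ ps) = Func.cong f p ∷ map-cong f ps

  comp-law : ∀ {VG VH VK : Setoid 0ℓ 0ℓ} {EG EH EK : Setoid 0ℓ 0ℓ}
    (σG : Func EG (Word VG)) (σH : Func EH (Word VH)) (σK : Func EK (Word VK))
    (hf : Func EG EH) (kf : Func VG VH) (hg : Func EH EK) (kg : Func VH VK) →
    (∀ e → Setoid._≈_ (Word VH) (to σH (to hf e)) (map (to kf) (to σG e))) →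
    (∀ e → Setoid._≈_ (Word VK) (to σK (to hg e)) (map (to kg) (to σH e))) →
    ∀ e → Setoid._≈_ (Word VK) (to σK (to hg (to hf e)))
                               (map (λ v → to kg (to kf v)) (to σG e))
  comp-law {VK = VK} σG σH σK hf kf hg kg pf pg e =
    trans (pg (to hf e)) (trans (map-cong kg (pf e))
      (reflexive (≡.sym (map-∘ (to σG e)))))
    where open Setoid (Word VK)

_∘Hyp_ : ∀ {G H K} → HypMor H K → HypMor G H → HypMor G K
_∘Hyp_ {G} {H} {K} g f = record
  { h = record { to = λ e → to (h g) (to (h f) e)
               ; cong = λ p → Func.cong (h g) (Func.cong (h f) p) }
  ; k = record { to = λ v → to (k g) (to (k f) v)
               ; cong = λ p → Func.cong (k g) (Func.cong (k f) p) }
  ; s-comm = comp-law (s G) (s H) (s K) (h f) (k f) (h g) (k g) (s-comm f) (s-comm g)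
  ; t-comm = comp-law (t G) (t H) (t K) (h f) (k f) (h g) (k g) (t-comm f) (t-comm g)
  }

record Signature : Set₁ where
  field
    O  : Set
    ar : O → ℕ
open Signature public

𝒢 : Signature → Hypergraph
𝒢 S = record
  { E = ≡.setoid (O S)
  ; V = ≡.setoid ⊤
  ; s = record { to = λ o → replicate (ar S o) tt
               ; cong = λ { refl → Setoid.refl (Word (≡.setoid ⊤)) } }
  ; t = record { to = λ o → [ tt ]
               ; cong = λ _ → Setoid.refl (Word (≡.setoid ⊤)) }
  }

record HypΣObj (S : Signature) : Set₁ where
  field
    graph : Hypergraph
    π     : HypMor graph (𝒢 S)
open HypΣObj public

record HypΣMor {S : Signature} (A B : HypΣObj S) : Set where
  field
    mor  : HypMor (graph A) (graph B)
    over : (π B ∘Hyp mor) ≈Hyp π A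
open HypΣMor public

private
  ∘-over : ∀ {S} {A B C : HypΣObj S} (g : HypΣMor B C) (f : HypΣMor A B) →
           (π C ∘Hyp (mor g ∘Hyp mor f)) ≈Hyp π A
  ∘-over g f = (λ e → ≡.trans (proj₁ (over g) (to (h (mor f)) e)) (proj₁ (over f) e))
             , (λ v → refl)

HypΣ : Signature → Category
HypΣ S = record
  { Obj = HypΣObj S
  ; Hom = HypΣMor
  ; _≈_ = λ f g → mor f ≈Hyp mor g
  ; _∘_ = λ g f → record { mor = mor g ∘Hyp mor f ; over = ∘-over g f }
  }

{-# OPTIONS --safe #-}

-- Everything in Hyp_Σ is computed separately on hyperedges and on nodes: a square is a
-- pullback, or a pushout along a mono, exactly when its edge and node squares are
-- pullbacks, resp. pushouts, of setoids, the attached words and labels being carried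
-- along.  One direction builds mediating morphisms componentwise; the other compares the
-- square with the explicit componentwise construction.  Hence monos are the componentwise
-- injections (look at the kernel pair), and the Van Kampen property reduces to Van Kampen
-- squares of setoids, which are checked elementwise using the explicit description of a
-- pushout along an injection.

module Submission where

open import Level using (0ℓ)
open import Defs
open import Data.Product using (_×_; Σ-syntax; _,_; proj₁; proj₂)
open import Data.Sum using (_⊎_; inj₁; inj₂; [_,_]′)
open import Data.Unit using (tt)
open import Data.List using (List; []; _∷_; map)
open import Data.List.Properties using (map-id)
import Function.Construct.Identity as Identity
import Data.List.Relation.Binary.Pointwise as PW
open PW using (Pointwise; []; _∷_)
open import Function.Bundles using (Func; _⇔_; mk⇔; Equivalence)
open import Function.Definitions using (Injective)
open import Relation.Binary.Bundles using (Setoid)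
open import Relation.Binary.PropositionalEquality as ≡ using (_≡_; refl)
import Relation.Binary.Reasoning.Setoid as ≈-Reasoning

open Func using (to; cong)
open Setoid using (Carrier)

infix 4 Eq
Eq : (S : Setoid 0ℓ 0ℓ) → Carrier S → Carrier S → Set
Eq = Setoid._≈_
syntax Eq S x y = x ≈[ S ] y

infixr 20 _∙_
_∙_ : ∀ {A B : Setoid 0ℓ 0ℓ} → Func A B → Carrier A → Carrier B
_∙_ = to

InjectiveFunc : ∀ {A B : Setoid 0ℓ 0ℓ} → Func A B → Set
InjectiveFunc {A} {B} f = Injective (Setoid._≈_ A) (Setoid._≈_ B) (to f)

Fiber : ∀ {A B : Setoid 0ℓ 0ℓ} → Func A B → Carrier B → Set
Fiber {A} {B} f y = Σ[ x ∈ Carrier A ] f ∙ x ≈[ B ] y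

wordMap : ∀ {X Y : Setoid 0ℓ 0ℓ} → Func X Y → Func (Word X) (Word Y)
wordMap f = record { to = map (to f) ; cong = map-cong }
  where
  map-cong : ∀ {xs ys} → Pointwise _ xs ys → Pointwise _ (map (to f) xs) (map (to f) ys)
  map-cong [] = []
  map-cong (p ∷ ps) = cong f p ∷ map-cong ps

pointwise-zip : ∀ {X Y : Set} {R S T : X → Y → Set} → (∀ {x y} → R x y → S x y → T x y) →
                ∀ {xs ys} → Pointwise R xs ys → Pointwise S xs ys → Pointwise T xs ys
pointwise-zip k [] [] = []
pointwise-zip k (r ∷ rs) (s ∷ ss) = k r s ∷ pointwise-zip k rs ss

pointwise-map-map : ∀ {X Y X' Y' : Set} {R : X' → Y' → Set} (F : X → X') (G : Y → Y') (H : X → Y) →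
                    (∀ x → R (F x) (G (H x))) → ∀ xs → Pointwise R (map F xs) (map G (map H xs))
pointwise-map-map F G H k [] = []
pointwise-map-map F G H k (x ∷ xs) = k x ∷ pointwise-map-map F G H k xs

-- Pullbacks and pushouts of setoids, described elementwise

record IsSetoidPullback {P A B C : Setoid 0ℓ 0ℓ}
         (p₁ : Func P A) (p₂ : Func P B) (f : Func A C) (g : Func B C) : Set where
  field
    commute           : ∀ x → f ∙ p₁ ∙ x ≈[ C ] g ∙ p₂ ∙ x
    jointly-injective : ∀ {x y} → p₁ ∙ x ≈[ A ] p₁ ∙ y → p₂ ∙ x ≈[ B ] p₂ ∙ y → x ≈[ P ] y
    pair              : ∀ a b → f ∙ a ≈[ C ] g ∙ b →
                        Σ[ x ∈ Carrier P ] (p₁ ∙ x ≈[ A ] a × p₂ ∙ x ≈[ B ] b)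

module _ {P A B C X : Setoid 0ℓ 0ℓ} {p₁ : Func P A} {p₂ : Func P B} {f : Func A C} {g : Func B C}
         (pb : IsSetoidPullback p₁ p₂ f g) (q₁ : Func X A) (q₂ : Func X B)
         (q-commute : ∀ x → f ∙ q₁ ∙ x ≈[ C ] g ∙ q₂ ∙ x) where
  open IsSetoidPullback pb
  private
    module A = Setoid A
    module B = Setoid B

    paired : ∀ x → Σ[ y ∈ Carrier P ] (p₁ ∙ y ≈[ A ] q₁ ∙ x × p₂ ∙ y ≈[ B ] q₂ ∙ x)
    paired x = pair (q₁ ∙ x) (q₂ ∙ x) (q-commute x)

    point : Carrier X → Carrier P
    point x = proj₁ (paired x)

    point-p₁ : ∀ x → p₁ ∙ point x ≈[ A ] q₁ ∙ x
    point-p₁ x = proj₁ (proj₂ (paired x))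

    point-p₂ : ∀ x → p₂ ∙ point x ≈[ B ] q₂ ∙ x
    point-p₂ x = proj₂ (proj₂ (paired x))

  mediate : Func X P
  mediate = record
    { to   = point
    ; cong = λ {x} {y} e → jointly-injective (A.trans (point-p₁ x) (A.trans (cong q₁ e) (A.sym (point-p₁ y))))
                                             (B.trans (point-p₂ x) (B.trans (cong q₂ e) (B.sym (point-p₂ y))))
    }

  mediate-p₁ : ∀ x → p₁ ∙ mediate ∙ x ≈[ A ] q₁ ∙ x
  mediate-p₁ = point-p₁

  mediate-p₂ : ∀ x → p₂ ∙ mediate ∙ x ≈[ B ] q₂ ∙ x
  mediate-p₂ = point-p₂

  mediate-unique : (u : Func X P) →
                   (∀ x → p₁ ∙ u ∙ x ≈[ A ] q₁ ∙ x) → (∀ x → p₂ ∙ u ∙ x ≈[ B ] q₂ ∙ x) →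
                   ∀ x → u ∙ x ≈[ P ] mediate ∙ x
  mediate-unique u u₁ u₂ x = jointly-injective (A.trans (u₁ x) (A.sym (point-p₁ x)))
                                               (B.trans (u₂ x) (B.sym (point-p₂ x)))

-- The elementwise description of a pushout along an injective m; along an arbitrary m,
-- i₂ need not be injective and i₁ may identify more than i₁-kernel allows.
record IsSetoidPushout {A B C D : Setoid 0ℓ 0ℓ}
         (i₁ : Func A D) (i₂ : Func B D) (m : Func C A) (f : Func C B) : Set where
  field
    commute            : ∀ c → i₁ ∙ m ∙ c ≈[ D ] i₂ ∙ f ∙ c
    jointly-surjective : ∀ x → Fiber i₁ x ⊎ Fiber i₂ x
    i₂-injective       : InjectiveFunc i₂
    glued              : ∀ a b → i₁ ∙ a ≈[ D ] i₂ ∙ b →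
                         Σ[ c ∈ Carrier C ] (m ∙ c ≈[ A ] a × f ∙ c ≈[ B ] b)
    i₁-kernel          : ∀ a a' → i₁ ∙ a ≈[ D ] i₁ ∙ a' →
                         a ≈[ A ] a' ⊎ Σ[ c ∈ Carrier C ] Σ[ c' ∈ Carrier C ]
                           (m ∙ c ≈[ A ] a × m ∙ c' ≈[ A ] a' × f ∙ c ≈[ B ] f ∙ c')

pullback-preserves-injective :
  ∀ {P A B C : Setoid 0ℓ 0ℓ} {p₁ : Func P A} {p₂ : Func P B} {f : Func A C} {g : Func B C} →
  IsSetoidPullback p₁ p₂ f g → InjectiveFunc g → InjectiveFunc p₁
pullback-preserves-injective {A = A} {C = C} {p₁} {p₂} {f} pb g-inj {x} {y} e =
  jointly-injective e (g-inj (C.trans (C.sym (commute x)) (C.trans (cong f e) (commute y))))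
  where
  open IsSetoidPullback pb
  module C = Setoid C

isSetoidPullback-retract :
  ∀ {P P₀ A B C : Setoid 0ℓ 0ℓ} {p₁ : Func P A} {p₂ : Func P B} {π₁ : Func P₀ A} {π₂ : Func P₀ B}
    {f : Func A C} {g : Func B C} →
  IsSetoidPullback π₁ π₂ f g → (u : Func P₀ P) (v : Func P P₀) →
  (∀ z → p₁ ∙ u ∙ z ≈[ A ] π₁ ∙ z) → (∀ z → p₂ ∙ u ∙ z ≈[ B ] π₂ ∙ z) →
  (∀ x → π₁ ∙ v ∙ x ≈[ A ] p₁ ∙ x) → (∀ x → π₂ ∙ v ∙ x ≈[ B ] p₂ ∙ x) →
  (∀ x → u ∙ v ∙ x ≈[ P ] x) → IsSetoidPullback p₁ p₂ f g
isSetoidPullback-retract {P} {P₀} {A} {B} {C} {p₁} {p₂} {π₁} {π₂} {f} {g} pb u v u₁ u₂ v₁ v₂ uv≈id =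
  record { commute = commute' ; jointly-injective = jointly-injective' ; pair = pair' }
  where
  open IsSetoidPullback pb
  module P = Setoid P
  module A = Setoid A
  module B = Setoid B
  module C = Setoid C
  commute' : ∀ x → f ∙ p₁ ∙ x ≈[ C ] g ∙ p₂ ∙ x
  commute' x = C.trans (cong f (A.sym (v₁ x))) (C.trans (commute (v ∙ x)) (cong g (v₂ x)))
  jointly-injective' : ∀ {x y} → p₁ ∙ x ≈[ A ] p₁ ∙ y → p₂ ∙ x ≈[ B ] p₂ ∙ y → x ≈[ P ] y
  jointly-injective' {x} {y} e₁ e₂ = P.trans (P.sym (uv≈id x)) (P.trans (cong u vx≈vy) (uv≈id y))
    where
    vx≈vy = jointly-injective (A.trans (v₁ x) (A.trans e₁ (A.sym (v₁ y))))
                              (B.trans (v₂ x) (B.trans e₂ (B.sym (v₂ y))))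
  pair' : ∀ a b → f ∙ a ≈[ C ] g ∙ b → Σ[ x ∈ Carrier P ] (p₁ ∙ x ≈[ A ] a × p₂ ∙ x ≈[ B ] b)
  pair' a b e = let (z , z₁ , z₂) = pair a b e in u ∙ z , A.trans (u₁ z) z₁ , B.trans (u₂ z) z₂

isSetoidPushout-retract :
  ∀ {A B C D D₀ : Setoid 0ℓ 0ℓ} {i₁ : Func A D} {i₂ : Func B D} {ι₁ : Func A D₀} {ι₂ : Func B D₀}
    {m : Func C A} {f : Func C B} →
  IsSetoidPushout ι₁ ι₂ m f → (u : Func D D₀) (v : Func D₀ D) →
  (∀ a → u ∙ i₁ ∙ a ≈[ D₀ ] ι₁ ∙ a) → (∀ b → u ∙ i₂ ∙ b ≈[ D₀ ] ι₂ ∙ b) →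
  (∀ a → v ∙ ι₁ ∙ a ≈[ D ] i₁ ∙ a) → (∀ b → v ∙ ι₂ ∙ b ≈[ D ] i₂ ∙ b) →
  (∀ x → v ∙ u ∙ x ≈[ D ] x) → IsSetoidPushout i₁ i₂ m f
isSetoidPushout-retract {A} {B} {C} {D} {D₀} {i₁} {i₂} {ι₁} {ι₂} {m} {f} po u v u₁ u₂ v₁ v₂ vu≈id =
  record
    { commute            = λ c → D.trans (D.sym (v₁ (m ∙ c))) (D.trans (cong v (commute c)) (v₂ (f ∙ c)))
    ; jointly-surjective = jointly-surjective'
    ; i₂-injective       = λ {b} {b'} e → i₂-injective (via (u₂ b) (cong u e) (u₂ b'))
    ; glued              = λ a b e → glued a b (via (u₁ a) (cong u e) (u₂ b))
    ; i₁-kernel          = λ a a' e → i₁-kernel a a' (via (u₁ a) (cong u e) (u₁ a'))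
    }
  where
  open IsSetoidPushout po
  module D = Setoid D
  module D₀ = Setoid D₀
  via : ∀ {x y x' y'} → x ≈[ D₀ ] x' → x ≈[ D₀ ] y → y ≈[ D₀ ] y' → x' ≈[ D₀ ] y'
  via p q r = D₀.trans (D₀.sym p) (D₀.trans q r)
  jointly-surjective' : ∀ x → Fiber i₁ x ⊎ Fiber i₂ x
  jointly-surjective' x with jointly-surjective (u ∙ x)
  ... | inj₁ (a , e) = inj₁ (a , D.trans (D.sym (v₁ a)) (D.trans (cong v e) (vu≈id x)))
  ... | inj₂ (b , e) = inj₂ (b , D.trans (D.sym (v₂ b)) (D.trans (cong v e) (vu≈id x)))

module SetoidPullback {A B C : Setoid 0ℓ 0ℓ} (f : Func A C) (g : Func B C) where
  private
    module A = Setoid A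
    module B = Setoid B

  Related : Carrier A → Carrier B → Set
  Related a b = f ∙ a ≈[ C ] g ∙ b

  Element : Set
  Element = Σ[ a ∈ Carrier A ] Σ[ b ∈ Carrier B ] Related a b

  _≋_ : Element → Element → Set
  (a , b , _) ≋ (a' , b' , _) = a A.≈ a' × b B.≈ b'

  setoid : Setoid 0ℓ 0ℓ
  setoid = record
    { Carrier = Element
    ; _≈_ = _≋_
    ; isEquivalence = record
      { refl  = A.refl , B.refl
      ; sym   = λ (p , q) → A.sym p , B.sym q
      ; trans = λ (p , q) (p' , q') → A.trans p p' , B.trans q q'
      }
    }

  π₁ : Func setoid A
  π₁ = record { to = proj₁ ; cong = proj₁ }

  π₂ : Func setoid B
  π₂ = record { to = λ z → proj₁ (proj₂ z) ; cong = proj₂ }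

  isSetoidPullback : IsSetoidPullback π₁ π₂ f g
  isSetoidPullback = record
    { commute           = λ z → proj₂ (proj₂ z)
    ; jointly-injective = _,_
    ; pair              = λ a b r → (a , b , r) , A.refl , B.refl
    }

  zipWord : ∀ {as bs} → Pointwise Related as bs → List Element
  zipWord [] = []
  zipWord {a ∷ _} {b ∷ _} (r ∷ rs) = (a , b , r) ∷ zipWord rs

  zipWord-cong : ∀ {as bs as' bs'} → Pointwise A._≈_ as as' → Pointwise B._≈_ bs bs' →
                 (rs : Pointwise Related as bs) (rs' : Pointwise Related as' bs') →
                 Pointwise _≋_ (zipWord rs) (zipWord rs')
  zipWord-cong [] [] [] [] = []
  zipWord-cong (p ∷ ps) (q ∷ qs) (_ ∷ rs) (_ ∷ rs') = (p , q) ∷ zipWord-cong ps qs rs rs'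

  map-π₁-zipWord : ∀ {as bs} (rs : Pointwise Related as bs) → map (to π₁) (zipWord rs) ≡ as
  map-π₁-zipWord [] = refl
  map-π₁-zipWord (_ ∷ rs) = ≡.cong (_ ∷_) (map-π₁-zipWord rs)

  map-π₂-zipWord : ∀ {as bs} (rs : Pointwise Related as bs) → map (to π₂) (zipWord rs) ≡ bs
  map-π₂-zipWord [] = refl
  map-π₂-zipWord (_ ∷ rs) = ≡.cong (_ ∷_) (map-π₂-zipWord rs)

module SetoidPushout {A B C : Setoid 0ℓ 0ℓ} (m : Func C A) (f : Func C B) (m-injective : InjectiveFunc m) where
  private
    module A = Setoid A
    module B = Setoid B

  Glued : Carrier A → Carrier B → Set
  Glued a b = Σ[ c ∈ Carrier C ] (m ∙ c A.≈ a × f ∙ c B.≈ b)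

  _~_ : Carrier A ⊎ Carrier B → Carrier A ⊎ Carrier B → Set
  inj₁ a ~ inj₁ a' = a A.≈ a' ⊎ Σ[ c ∈ Carrier C ] Σ[ c' ∈ Carrier C ]
                                   (m ∙ c A.≈ a × m ∙ c' A.≈ a' × f ∙ c B.≈ f ∙ c')
  inj₁ a ~ inj₂ b  = Glued a b
  inj₂ b ~ inj₁ a  = Glued a b
  inj₂ b ~ inj₂ b' = b B.≈ b'

  private
    ~-refl : ∀ {x} → x ~ x
    ~-refl {inj₁ a} = inj₁ A.refl
    ~-refl {inj₂ b} = B.refl

    ~-sym : ∀ {x y} → x ~ y → y ~ x
    ~-sym {inj₁ _} {inj₁ _} (inj₁ e) = inj₁ (A.sym e)
    ~-sym {inj₁ _} {inj₁ _} (inj₂ (c , c' , p , q , r)) = inj₂ (c' , c , q , p , B.sym r)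
    ~-sym {inj₁ _} {inj₂ _} e = e
    ~-sym {inj₂ _} {inj₁ _} e = e
    ~-sym {inj₂ _} {inj₂ _} e = B.sym e

    -- Injectivity of m is what makes _~_ transitive.
    f-agrees : ∀ {c c' a} → m ∙ c A.≈ a → m ∙ c' A.≈ a → f ∙ c B.≈ f ∙ c'
    f-agrees p q = cong f (m-injective (A.trans p (A.sym q)))

    ~-trans : ∀ {x y z} → x ~ y → y ~ z → x ~ z
    ~-trans {inj₁ _} {inj₁ _} {inj₁ _} (inj₁ e) (inj₁ e') = inj₁ (A.trans e e')
    ~-trans {inj₁ _} {inj₁ _} {inj₁ _} (inj₁ e) (inj₂ (c , c' , p , q , r)) =
      inj₂ (c , c' , A.trans p (A.sym e) , q , r)
    ~-trans {inj₁ _} {inj₁ _} {inj₁ _} (inj₂ (c , c' , p , q , r)) (inj₁ e) =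
      inj₂ (c , c' , p , A.trans q e , r)
    ~-trans {inj₁ _} {inj₁ _} {inj₁ _} (inj₂ (c₁ , _ , p₁ , q₁ , r₁)) (inj₂ (_ , c₄ , p₂ , q₂ , r₂)) =
      inj₂ (c₁ , c₄ , p₁ , q₂ , B.trans r₁ (B.trans (f-agrees q₁ p₂) r₂))
    ~-trans {inj₁ _} {inj₁ _} {inj₂ _} (inj₁ e) (c , p , q) = c , A.trans p (A.sym e) , q
    ~-trans {inj₁ _} {inj₁ _} {inj₂ _} (inj₂ (c₁ , _ , p₁ , q₁ , r₁)) (_ , p , q) =
      c₁ , p₁ , B.trans r₁ (B.trans (f-agrees q₁ p) q)
    ~-trans {inj₁ _} {inj₂ _} {inj₁ _} (c , p , q) (c' , p' , q') = inj₂ (c , c' , p , p' , B.trans q (B.sym q'))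
    ~-trans {inj₁ _} {inj₂ _} {inj₂ _} (c , p , q) e = c , p , B.trans q e
    ~-trans {inj₂ _} {inj₁ _} {inj₁ _} (c , p , q) (inj₁ e) = c , A.trans p e , q
    ~-trans {inj₂ _} {inj₁ _} {inj₁ _} (_ , p , q) (inj₂ (c₁ , c₂ , p₁ , q₁ , r₁)) =
      c₂ , q₁ , B.trans (B.sym r₁) (B.trans (f-agrees p₁ p) q)
    ~-trans {inj₂ _} {inj₁ _} {inj₂ _} (_ , p , q) (_ , p' , q') = B.trans (B.sym q) (B.trans (f-agrees p p') q')
    ~-trans {inj₂ _} {inj₂ _} {inj₁ _} e (c , p , q) = c , p , B.trans q (B.sym e)
    ~-trans {inj₂ _} {inj₂ _} {inj₂ _} e e' = B.trans e e'

  setoid : Setoid 0ℓ 0ℓ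
  setoid = record
    { Carrier = Carrier A ⊎ Carrier B
    ; _≈_ = _~_
    ; isEquivalence = record
      { refl  = λ {x} → ~-refl {x}
      ; sym   = λ {x} {y} → ~-sym {x} {y}
      ; trans = λ {x} {y} {z} → ~-trans {x} {y} {z}
      }
    }

  ι₁ : Func A setoid
  ι₁ = record { to = inj₁ ; cong = inj₁ }

  ι₂ : Func B setoid
  ι₂ = record { to = inj₂ ; cong = λ e → e }

  isSetoidPushout : IsSetoidPushout ι₁ ι₂ m f
  isSetoidPushout = record
    { commute            = λ c → c , A.refl , B.refl
    ; jointly-surjective = λ { (inj₁ a) → inj₁ (a , inj₁ A.refl) ; (inj₂ b) → inj₂ (b , B.refl) }
    ; i₂-injective       = λ e → e
    ; glued              = λ _ _ e → e
    ; i₁-kernel          = λ _ _ e → e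
    }

module Copairing {A B C D X : Setoid 0ℓ 0ℓ} {i₁ : Func A D} {i₂ : Func B D} {m : Func C A} {f : Func C B}
  (po : IsSetoidPushout i₁ i₂ m f) (j₁ : Func A X) (j₂ : Func B X)
  (j-commute : ∀ c → j₁ ∙ m ∙ c ≈[ X ] j₂ ∙ f ∙ c) where
  private
    open IsSetoidPushout po
    module X = Setoid X
    module D = Setoid D

    value : ∀ {x} → Fiber i₁ x ⊎ Fiber i₂ x → Carrier X
    value (inj₁ (a , _)) = j₁ ∙ a
    value (inj₂ (b , _)) = j₂ ∙ b

    through-C : ∀ {a b} c → m ∙ c ≈[ A ] a → f ∙ c ≈[ B ] b → j₁ ∙ a ≈[ X ] j₂ ∙ b
    through-C c p q = X.trans (cong j₁ (Setoid.sym A p)) (X.trans (j-commute c) (cong j₂ q))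

    value-cong : ∀ {x y} (w : Fiber i₁ x ⊎ Fiber i₂ x) (w' : Fiber i₁ y ⊎ Fiber i₂ y) →
                 x D.≈ y → value w X.≈ value w'
    value-cong (inj₁ (a , p)) (inj₁ (a' , p')) e with i₁-kernel a a' (D.trans p (D.trans e (D.sym p')))
    ... | inj₁ a≈a' = cong j₁ a≈a'
    ... | inj₂ (c , c' , q , q' , r) =
      X.trans (through-C c q (Setoid.refl B)) (X.trans (cong j₂ r) (X.sym (through-C c' q' (Setoid.refl B))))
    value-cong (inj₁ (a , p)) (inj₂ (b , p')) e =
      let (c , q , r) = glued a b (D.trans p (D.trans e (D.sym p'))) in through-C c q r
    value-cong (inj₂ (b , p)) (inj₁ (a , p')) e =
      let (c , q , r) = glued a b (D.trans p' (D.trans (D.sym e) (D.sym p))) in X.sym (through-C c q r)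
    value-cong (inj₂ (b , p)) (inj₂ (b' , p')) e = cong j₂ (i₂-injective (D.trans p (D.trans e (D.sym p'))))

  copair : Func D X
  copair = record
    { to   = λ x → value (jointly-surjective x)
    ; cong = λ {x} {y} → value-cong (jointly-surjective x) (jointly-surjective y)
    }

  copair-i₁ : ∀ a → copair ∙ i₁ ∙ a ≈[ X ] j₁ ∙ a
  copair-i₁ a = value-cong (jointly-surjective (i₁ ∙ a)) (inj₁ (a , D.refl)) D.refl

  copair-i₂ : ∀ b → copair ∙ i₂ ∙ b ≈[ X ] j₂ ∙ b
  copair-i₂ b = value-cong (jointly-surjective (i₂ ∙ b)) (inj₂ (b , D.refl)) D.refl

  copair-unique : (u : Func D X) →
                  (∀ a → u ∙ i₁ ∙ a ≈[ X ] j₁ ∙ a) → (∀ b → u ∙ i₂ ∙ b ≈[ X ] j₂ ∙ b) →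
                  ∀ x → u ∙ x ≈[ X ] copair ∙ x
  copair-unique u u₁ u₂ x = agree (jointly-surjective x)
    where
    agree : (w : Fiber i₁ x ⊎ Fiber i₂ x) → u ∙ x ≈[ X ] value w
    agree (inj₁ (a , p)) = X.trans (cong u (D.sym p)) (u₁ a)
    agree (inj₂ (b , p)) = X.trans (cong u (D.sym p)) (u₂ b)

module SetoidVanKampen {A B C D A' B' C' D' : Setoid 0ℓ 0ℓ}
  (m : Func C A) (f : Func C B) (i₁ : Func A D) (i₂ : Func B D)
  (m' : Func C' A') (f' : Func C' B') (i₁' : Func A' D') (i₂' : Func B' D')
  (a : Func A' A) (b : Func B' B) (c : Func C' C) (d : Func D' D)
  (m-injective : InjectiveFunc m) (bottom : IsSetoidPushout i₁ i₂ m f)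
  (top-commute : ∀ x → i₁' ∙ m' ∙ x ≈[ D' ] i₂' ∙ f' ∙ x)
  (front-A-commute : ∀ x → i₁ ∙ a ∙ x ≈[ D ] d ∙ i₁' ∙ x)
  (front-B-commute : ∀ x → i₂ ∙ b ∙ x ≈[ D ] d ∙ i₂' ∙ x)
  (back-A : IsSetoidPullback m' c a m) (back-B : IsSetoidPullback f' c b f) where
  private
    module A = Setoid A
    module B = Setoid B
    module D = Setoid D
    module A' = Setoid A'
    module D' = Setoid D'
    module bottom = IsSetoidPushout bottom
    module back-A = IsSetoidPullback back-A
    module back-B = IsSetoidPullback back-B

  top-pushout⇒front-pullbacks : IsSetoidPushout i₁' i₂' m' f' →
                                IsSetoidPullback i₁' a d i₁ × IsSetoidPullback i₂' b d i₂
  top-pushout⇒front-pullbacks top =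
    record { commute           = λ x → D.sym (front-A-commute x)
           ; jointly-injective = A-jointly-injective
           ; pair              = A-pair
           } ,
    record { commute           = λ x → D.sym (front-B-commute x)
           ; jointly-injective = λ e _ → top.i₂-injective e
           ; pair              = B-pair
           }
    where
    module top = IsSetoidPushout top

    A-jointly-injective : ∀ {x y} → i₁' ∙ x ≈[ D' ] i₁' ∙ y → a ∙ x ≈[ A ] a ∙ y → x ≈[ A' ] y
    A-jointly-injective {x} {y} e₁ e₂ with top.i₁-kernel x y e₁
    ... | inj₁ x≈y = x≈y
    ... | inj₂ (c₁ , c₂ , p₁ , p₂ , f'c₁≈f'c₂) = A'.trans (A'.sym p₁) (A'.trans (cong m' c₁≈c₂) p₂)
      where
      cc₁≈cc₂ : c ∙ c₁ ≈[ C ] c ∙ c₂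
      cc₁≈cc₂ = m-injective (A.trans (A.sym (back-A.commute c₁)) (A.trans (cong a p₁) (A.trans e₂
                  (A.trans (cong a (A'.sym p₂)) (back-A.commute c₂)))))
      c₁≈c₂ = back-B.jointly-injective f'c₁≈f'c₂ cc₁≈cc₂

    A-pair : ∀ x a₀ → d ∙ x ≈[ D ] i₁ ∙ a₀ →
             Σ[ y ∈ Carrier A' ] (i₁' ∙ y ≈[ D' ] x × a ∙ y ≈[ A ] a₀)
    A-pair x a₀ e with top.jointly-surjective x
    ... | inj₁ (a₁ , q) with bottom.i₁-kernel (a ∙ a₁) a₀ (D.trans (front-A-commute a₁) (D.trans (cong d q) e))
    ... | inj₁ r = a₁ , q , r
    -- a ∙ a₁ and a₀ are glued through C; lift the gluing to C' along the back pullbacks.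
    ... | inj₂ (k₁ , k₂ , r₁ , r₂ , r₃) =
      let (c₁ , s₁ , s₂) = back-A.pair a₁ k₁ (A.sym r₁)
          (c₂ , t₁ , t₂) = back-B.pair (f' ∙ c₁) k₂ (B.trans (back-B.commute c₁) (B.trans (cong f s₂) r₃))
      in m' ∙ c₂
       , D'.trans (top-commute c₂) (D'.trans (cong i₂' t₁) (D'.trans (D'.sym (top-commute c₁))
           (D'.trans (cong i₁' s₁) q)))
       , A.trans (back-A.commute c₂) (A.trans (cong m t₂) r₂)
    A-pair x a₀ e | inj₂ (b₁ , q) =
      let (k , r₁ , r₂) = bottom.glued a₀ (b ∙ b₁)
                            (D.trans (D.sym e) (D.trans (cong d (D'.sym q)) (D.sym (front-B-commute b₁))))
          (c₁ , s₁ , s₂) = back-B.pair b₁ k (B.sym r₂)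
      in m' ∙ c₁
       , D'.trans (top-commute c₁) (D'.trans (cong i₂' s₁) q)
       , A.trans (back-A.commute c₁) (A.trans (cong m s₂) r₁)

    B-pair : ∀ x b₀ → d ∙ x ≈[ D ] i₂ ∙ b₀ →
             Σ[ y ∈ Carrier B' ] (i₂' ∙ y ≈[ D' ] x × b ∙ y ≈[ B ] b₀)
    B-pair x b₀ e with top.jointly-surjective x
    ... | inj₁ (a₁ , q) =
      let (k , r₁ , r₂) = bottom.glued (a ∙ a₁) b₀ (D.trans (front-A-commute a₁) (D.trans (cong d q) e))
          (c₁ , s₁ , s₂) = back-A.pair a₁ k (A.sym r₁)
      in f' ∙ c₁
       , D'.trans (D'.sym (top-commute c₁)) (D'.trans (cong i₁' s₁) q)
       , B.trans (back-B.commute c₁) (B.trans (cong f s₂) r₂)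
    ... | inj₂ (b₁ , q) = b₁ , q , bottom.i₂-injective (D.trans (front-B-commute b₁) (D.trans (cong d q) e))

  front-pullbacks⇒top-pushout : IsSetoidPullback i₁' a d i₁ × IsSetoidPullback i₂' b d i₂ →
                                IsSetoidPushout i₁' i₂' m' f'
  front-pullbacks⇒top-pushout (front-A , front-B) = record
    { commute            = top-commute
    ; jointly-surjective = jointly-surjective
    ; i₂-injective       = i₂'-injective
    ; glued              = glued
    ; i₁-kernel          = i₁-kernel
    }
    where
    module front-A = IsSetoidPullback front-A
    module front-B = IsSetoidPullback front-B

    jointly-surjective : ∀ x → Fiber i₁' x ⊎ Fiber i₂' x
    jointly-surjective x with bottom.jointly-surjective (d ∙ x)
    ... | inj₁ (a₀ , q) = let (y , p , _) = front-A.pair x a₀ (D.sym q) in inj₁ (y , p)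
    ... | inj₂ (b₀ , q) = let (y , p , _) = front-B.pair x b₀ (D.sym q) in inj₂ (y , p)

    i₂'-injective : InjectiveFunc i₂'
    i₂'-injective {x} {y} e = front-B.jointly-injective e
      (bottom.i₂-injective (D.trans (front-B-commute x) (D.trans (cong d e) (D.sym (front-B-commute y)))))

    f'-agrees : ∀ {z b₁} → i₁' ∙ m' ∙ z ≈[ D' ] i₂' ∙ b₁ → f' ∙ z ≈[ B' ] b₁
    f'-agrees {z} e = i₂'-injective (D'.trans (D'.sym (top-commute z)) e)

    glued : ∀ a₁ b₁ → i₁' ∙ a₁ ≈[ D' ] i₂' ∙ b₁ →
            Σ[ z ∈ Carrier C' ] (m' ∙ z ≈[ A' ] a₁ × f' ∙ z ≈[ B' ] b₁)
    glued a₁ b₁ e =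
      let (k , r₁ , _) = bottom.glued (a ∙ a₁) (b ∙ b₁)
                           (D.trans (front-A-commute a₁) (D.trans (cong d e) (D.sym (front-B-commute b₁))))
          (z , s₁ , _) = back-A.pair a₁ k (A.sym r₁)
      in z , s₁ , f'-agrees (D'.trans (cong i₁' s₁) e)

    i₁-kernel : ∀ a₁ a₂ → i₁' ∙ a₁ ≈[ D' ] i₁' ∙ a₂ →
                a₁ ≈[ A' ] a₂ ⊎ Σ[ z ∈ Carrier C' ] Σ[ z' ∈ Carrier C' ]
                  (m' ∙ z ≈[ A' ] a₁ × m' ∙ z' ≈[ A' ] a₂ × f' ∙ z ≈[ B' ] f' ∙ z')
    i₁-kernel a₁ a₂ e
      with bottom.i₁-kernel (a ∙ a₁) (a ∙ a₂)
             (D.trans (front-A-commute a₁) (D.trans (cong d e) (D.sym (front-A-commute a₂))))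
    ... | inj₁ r = inj₁ (front-A.jointly-injective e r)
    ... | inj₂ (k₁ , k₂ , r₁ , r₂ , _) =
      let (z₁ , s₁ , _) = back-A.pair a₁ k₁ (A.sym r₁)
          (z₂ , s₂ , _) = back-A.pair a₂ k₂ (A.sym r₂)
      in inj₂ (z₁ , z₂ , s₁ , s₂ ,
               f'-agrees (D'.trans (cong i₁' s₁) (D'.trans e (D'.trans (cong i₁' (A'.sym s₂)) (top-commute z₂)))))

record Attachment : Set₁ where
  field
    word      : (G : Hypergraph) → Func (E G) (Word (V G))
    word-comm : ∀ {G H} (φ : HypMor G H) e →
                word H ∙ h φ ∙ e ≈[ Word (V H) ] map (to (k φ)) (word G ∙ e)
open Attachment

sources : Attachment
sources = record { word = s ; word-comm = s-comm }

targets : Attachment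
targets = record { word = t ; word-comm = t-comm }

mkHypMor : ∀ {G H} (hE : Func (E G) (E H)) (hV : Func (V G) (V H)) →
           (∀ σ e → word σ H ∙ hE ∙ e ≈[ Word (V H) ] map (to hV) (word σ G ∙ e)) → HypMor G H
mkHypMor hE hV comm = record { h = hE ; k = hV ; s-comm = comm sources ; t-comm = comm targets }

module _ (σ : Attachment) {G H K : Hypergraph} where
  open ≈-Reasoning (Word (V K))

  word-comm-through : (p : HypMor H K) (q : HypMor G K) (uE : Func (E G) (E H)) (uV : Func (V G) (V H)) →
    (∀ x → h p ∙ uE ∙ x ≈[ E K ] h q ∙ x) → (∀ v → k p ∙ uV ∙ v ≈[ V K ] k q ∙ v) →
    ∀ x → map (to (k p)) (word σ H ∙ uE ∙ x) ≈[ Word (V K) ] map (to (k p)) (map (to uV) (word σ G ∙ x))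
  word-comm-through p q uE uV pu≈q-edges pu≈q-nodes x = begin
    map (to (k p)) (word σ H ∙ uE ∙ x)  ≈⟨ word-comm σ p (uE ∙ x) ⟨
    word σ K ∙ h p ∙ uE ∙ x             ≈⟨ cong (word σ K) (pu≈q-edges x) ⟩
    word σ K ∙ h q ∙ x                  ≈⟨ word-comm σ q x ⟩
    map (to (k q)) (word σ G ∙ x)       ≈⟨ pointwise-map-map (to (k q)) (to (k p)) (to uV)
                                                              (λ v → Setoid.sym (V K) (pu≈q-nodes v)) _ ⟩
    map (to (k p)) (map (to uV) (word σ G ∙ x)) ∎

  word-comm-on-image : (i : HypMor G H) (j : HypMor G K) (uE : Func (E H) (E K)) (uV : Func (V H) (V K)) →
    (∀ x → uE ∙ h i ∙ x ≈[ E K ] h j ∙ x) → (∀ v → uV ∙ k i ∙ v ≈[ V K ] k j ∙ v) →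
    ∀ {y} → Fiber (h i) y → word σ K ∙ uE ∙ y ≈[ Word (V K) ] map (to uV) (word σ H ∙ y)
  word-comm-on-image i j uE uV ui≈j-edges ui≈j-nodes {y} (x , ix≈y) = begin
    word σ K ∙ uE ∙ y                       ≈⟨ cong (word σ K) (cong uE ix≈y) ⟨
    word σ K ∙ uE ∙ h i ∙ x                 ≈⟨ cong (word σ K) (ui≈j-edges x) ⟩
    word σ K ∙ h j ∙ x                      ≈⟨ word-comm σ j x ⟩
    map (to (k j)) (word σ G ∙ x)           ≈⟨ pointwise-map-map (to (k j)) (to uV) (to (k i))
                                                                  (λ v → Setoid.sym (V K) (ui≈j-nodes v)) _ ⟩
    map (to uV) (map (to (k i)) (word σ G ∙ x)) ≈⟨ cong (wordMap uV) (word-comm σ i x) ⟨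
    map (to uV) (word σ H ∙ h i ∙ x)        ≈⟨ cong (wordMap uV) (cong (word σ H) ix≈y) ⟩
    map (to uV) (word σ H ∙ y)              ∎

-- The slice category Hyp_Σ

module HypΣProperties (S : Signature) where
  open Category (HypΣ S) using (Obj; Hom; _≈_; _∘_)

  Eᵒ Vᵒ : Obj → Setoid 0ℓ 0ℓ
  Eᵒ X = E (graph X)
  Vᵒ X = V (graph X)

  hᵐ : ∀ {X Y} → Hom X Y → Func (Eᵒ X) (Eᵒ Y)
  hᵐ f = h (mor f)

  kᵐ : ∀ {X Y} → Hom X Y → Func (Vᵒ X) (Vᵒ Y)
  kᵐ f = k (mor f)

  label : (X : Obj) → Carrier (Eᵒ X) → O S
  label X e = h (π X) ∙ e

  ComponentwiseInjective : ∀ {X Y} → Hom X Y → Set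
  ComponentwiseInjective f = InjectiveFunc (hᵐ f) × InjectiveFunc (kᵐ f)

  ComponentwisePullback : ∀ {P A B C} → Hom P A → Hom P B → Hom A C → Hom B C → Set
  ComponentwisePullback p₁ p₂ f g =
    IsSetoidPullback (hᵐ p₁) (hᵐ p₂) (hᵐ f) (hᵐ g) × IsSetoidPullback (kᵐ p₁) (kᵐ p₂) (kᵐ f) (kᵐ g)

  ComponentwisePushout : ∀ {A B C D} → Hom A D → Hom B D → Hom C A → Hom C B → Set
  ComponentwisePushout i₁ i₂ m f =
    IsSetoidPushout (hᵐ i₁) (hᵐ i₂) (hᵐ m) (hᵐ f) × IsSetoidPushout (kᵐ i₁) (kᵐ i₂) (kᵐ m) (kᵐ f)

  mkHom : ∀ {X Y} (φ : HypMor (graph X) (graph Y)) → (∀ e → label Y (h φ ∙ e) ≡ label X e) → Hom X Y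
  mkHom φ preserves-label = record { mor = φ ; over = preserves-label , λ _ → refl }

  id : ∀ {X} → Hom X X
  id {X} = mkHom (mkHypMor (Identity.function (Eᵒ X)) (Identity.function (Vᵒ X))
                           (λ σ e → Setoid.reflexive (Word (Vᵒ X)) (≡.sym (map-id _))))
                 (λ _ → refl)

  ≈-refl : ∀ {X Y} (f : Hom X Y) → f ≈ f
  ≈-refl {Y = Y} _ = (λ _ → Setoid.refl (Eᵒ Y)) , (λ _ → Setoid.refl (Vᵒ Y))

  ≈-by-uniqueness : ∀ {X Y} (f g u : Hom X Y) → f ≈ u → g ≈ u → f ≈ g
  ≈-by-uniqueness {Y = Y} _ _ _ (fE , fV) (gE , gV) =
    (λ e → Setoid.trans (Eᵒ Y) (fE e) (Setoid.sym (Eᵒ Y) (gE e))) ,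
    (λ v → Setoid.trans (Vᵒ Y) (fV v) (Setoid.sym (Vᵒ Y) (gV v)))

  paste-≈ʳ : ∀ {W X Y Z} (p : Hom Y Z) (u : Hom X Y) (v : Hom W X) (q : Hom X Z) (r : Hom W Z) →
             p ∘ u ≈ q → q ∘ v ≈ r → p ∘ (u ∘ v) ≈ r
  paste-≈ʳ {Z = Z} p u v q r (eE , eV) (eE' , eV') =
    (λ x → Setoid.trans (Eᵒ Z) (eE (hᵐ v ∙ x)) (eE' x)) ,
    (λ x → Setoid.trans (Vᵒ Z) (eV (kᵐ v ∙ x)) (eV' x))

  paste-≈ˡ : ∀ {W X Y Z} (v : Hom Y Z) (u : Hom X Y) (i : Hom W X) (j : Hom W Y) (r : Hom W Z) →
             u ∘ i ≈ j → v ∘ j ≈ r → (v ∘ u) ∘ i ≈ r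
  paste-≈ˡ {Z = Z} v u i j r (eE , eV) (eE' , eV') =
    (λ x → Setoid.trans (Eᵒ Z) (cong (hᵐ v) (eE x)) (eE' x)) ,
    (λ x → Setoid.trans (Vᵒ Z) (cong (kᵐ v) (eV x)) (eV' x))

  pullback-endo≈id : ∀ {P A B C} (p₁ : Hom P A) (p₂ : Hom P B) (f : Hom A C) (g : Hom B C) →
    IsPullback (HypΣ S) p₁ p₂ f g → (w : Hom P P) → p₁ ∘ w ≈ p₁ → p₂ ∘ w ≈ p₂ → w ≈ id
  pullback-endo≈id p₁ p₂ f g (commute , universal) w w₁ w₂ =
    let (u , _ , _ , unique) = universal p₁ p₂ commute
    in ≈-by-uniqueness w id u (unique w w₁ w₂) (unique id (≈-refl p₁) (≈-refl p₂))

  pushout-endo≈id : ∀ {A B C D} (i₁ : Hom A D) (i₂ : Hom B D) (m : Hom C A) (f : Hom C B) →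
    IsPushout (HypΣ S) i₁ i₂ m f → (w : Hom D D) → w ∘ i₁ ≈ i₁ → w ∘ i₂ ≈ i₂ → w ≈ id
  pushout-endo≈id i₁ i₂ m f (commute , universal) w w₁ w₂ =
    let (u , _ , _ , unique) = universal i₁ i₂ commute
    in ≈-by-uniqueness w id u (unique w w₁ w₂) (unique id (≈-refl i₁) (≈-refl i₂))

  label-through : ∀ {X P A} (p : Hom P A) (q : Hom X A) (uE : Func (Eᵒ X) (Eᵒ P)) →
    (∀ x → hᵐ p ∙ uE ∙ x ≈[ Eᵒ A ] hᵐ q ∙ x) → ∀ x → label P (uE ∙ x) ≡ label X x
  label-through {A = A} p q uE pu≈q x =
    ≡.trans (≡.sym (proj₁ (over p) (uE ∙ x))) (≡.trans (cong (h (π A)) (pu≈q x)) (proj₁ (over q) x))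

  label-on-image : ∀ {A D X} (i : Hom A D) (j : Hom A X) (uE : Func (Eᵒ D) (Eᵒ X)) →
    (∀ a → uE ∙ hᵐ i ∙ a ≈[ Eᵒ X ] hᵐ j ∙ a) → ∀ {y} → Fiber (hᵐ i) y → label X (uE ∙ y) ≡ label D y
  label-on-image {D = D} {X} i j uE ui≈j (a , ia≈y) =
    ≡.trans (cong (h (π X)) (cong uE (Setoid.sym (Eᵒ D) ia≈y)))
      (≡.trans (cong (h (π X)) (ui≈j a)) (≡.trans (proj₁ (over j) a)
        (≡.trans (≡.sym (proj₁ (over i) a)) (cong (h (π D)) ia≈y))))

  module _ {P A B C : Obj} (p₁ : Hom P A) (p₂ : Hom P B) (f : Hom A C) (g : Hom B C)
           (edges : IsSetoidPullback (hᵐ p₁) (hᵐ p₂) (hᵐ f) (hᵐ g))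
           (nodes : IsSetoidPullback (kᵐ p₁) (kᵐ p₂) (kᵐ f) (kᵐ g)) where
    private
      words-jointly-injective : ∀ {xs ys} →
        map (to (kᵐ p₁)) xs ≈[ Word (Vᵒ A) ] map (to (kᵐ p₁)) ys →
        map (to (kᵐ p₂)) xs ≈[ Word (Vᵒ B) ] map (to (kᵐ p₂)) ys → xs ≈[ Word (Vᵒ P) ] ys
      words-jointly-injective r₁ r₂ =
        pointwise-zip (IsSetoidPullback.jointly-injective nodes) (PW.map⁻ _ _ r₁) (PW.map⁻ _ _ r₂)

      module Mediator {X} (q₁ : Hom X A) (q₂ : Hom X B) (q-commute : f ∘ q₁ ≈ g ∘ q₂) where
        commute-edges : ∀ x → hᵐ f ∙ hᵐ q₁ ∙ x ≈[ Eᵒ C ] hᵐ g ∙ hᵐ q₂ ∙ x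
        commute-edges = proj₁ q-commute

        commute-nodes : ∀ v → kᵐ f ∙ kᵐ q₁ ∙ v ≈[ Vᵒ C ] kᵐ g ∙ kᵐ q₂ ∙ v
        commute-nodes = proj₂ q-commute

        uE : Func (Eᵒ X) (Eᵒ P)
        uE = mediate edges (hᵐ q₁) (hᵐ q₂) commute-edges

        uV : Func (Vᵒ X) (Vᵒ P)
        uV = mediate nodes (kᵐ q₁) (kᵐ q₂) commute-nodes

        p₁∘u≈q₁ : (∀ x → hᵐ p₁ ∙ uE ∙ x ≈[ Eᵒ A ] hᵐ q₁ ∙ x) ×
                  (∀ v → kᵐ p₁ ∙ uV ∙ v ≈[ Vᵒ A ] kᵐ q₁ ∙ v)
        p₁∘u≈q₁ = mediate-p₁ edges (hᵐ q₁) (hᵐ q₂) commute-edges ,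
                  mediate-p₁ nodes (kᵐ q₁) (kᵐ q₂) commute-nodes

        p₂∘u≈q₂ : (∀ x → hᵐ p₂ ∙ uE ∙ x ≈[ Eᵒ B ] hᵐ q₂ ∙ x) ×
                  (∀ v → kᵐ p₂ ∙ uV ∙ v ≈[ Vᵒ B ] kᵐ q₂ ∙ v)
        p₂∘u≈q₂ = mediate-p₂ edges (hᵐ q₁) (hᵐ q₂) commute-edges ,
                  mediate-p₂ nodes (kᵐ q₁) (kᵐ q₂) commute-nodes

        u : Hom X P
        u = mkHom (mkHypMor uE uV λ σ x → words-jointly-injective
                     (word-comm-through σ (mor p₁) (mor q₁) uE uV (proj₁ p₁∘u≈q₁) (proj₂ p₁∘u≈q₁) x)
                     (word-comm-through σ (mor p₂) (mor q₂) uE uV (proj₁ p₂∘u≈q₂) (proj₂ p₂∘u≈q₂) x))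
                  (label-through p₁ q₁ uE (proj₁ p₁∘u≈q₁))

        unique : ∀ u' → p₁ ∘ u' ≈ q₁ → p₂ ∘ u' ≈ q₂ → u' ≈ u
        unique u' (u'₁ᴱ , u'₁ⱽ) (u'₂ᴱ , u'₂ⱽ) =
          mediate-unique edges (hᵐ q₁) (hᵐ q₂) commute-edges (hᵐ u') u'₁ᴱ u'₂ᴱ ,
          mediate-unique nodes (kᵐ q₁) (kᵐ q₂) commute-nodes (kᵐ u') u'₁ⱽ u'₂ⱽ

    componentwise⇒isPullback : IsPullback (HypΣ S) p₁ p₂ f g
    componentwise⇒isPullback =
      (IsSetoidPullback.commute edges , IsSetoidPullback.commute nodes) ,
      λ q₁ q₂ q-commute → let open Mediator q₁ q₂ q-commute in u , p₁∘u≈q₁ , p₂∘u≈q₂ , unique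

  module CanonicalPullback {A B C : Obj} (f : Hom A C) (g : Hom B C) where
    module PE = SetoidPullback (hᵐ f) (hᵐ g)
    module PV = SetoidPullback (kᵐ f) (kᵐ g)

    private
      related-words : (σ : Attachment) → ∀ {a b} → PE.Related a b →
                      Pointwise PV.Related (word σ (graph A) ∙ a) (word σ (graph B) ∙ b)
      related-words σ {a} {b} r = PW.map⁻ (to (kᵐ f)) (to (kᵐ g))
        (WC.trans (WC.sym (word-comm σ (mor f) a)) (WC.trans (cong (word σ (graph C)) r) (word-comm σ (mor g) b)))
        where module WC = Setoid (Word (Vᵒ C))

      zippedWord : Attachment → Func PE.setoid (Word PV.setoid)
      zippedWord σ = record
        { to   = λ (_ , _ , r) → PV.zipWord (related-words σ r)
        ; cong = λ { {_ , _ , r} {_ , _ , r'} (e₁ , e₂) →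
                     PV.zipWord-cong (cong (word σ (graph A)) e₁) (cong (word σ (graph B)) e₂)
                                     (related-words σ r) (related-words σ r') }
        }

      π₁-word : ∀ σ e → word σ (graph A) ∙ PE.π₁ ∙ e ≈[ Word (Vᵒ A) ] map (to PV.π₁) (zippedWord σ ∙ e)
      π₁-word σ _ = Setoid.reflexive (Word (Vᵒ A)) (≡.sym (PV.map-π₁-zipWord _))

      π₂-word : ∀ σ e → word σ (graph B) ∙ PE.π₂ ∙ e ≈[ Word (Vᵒ B) ] map (to PV.π₂) (zippedWord σ ∙ e)
      π₂-word σ _ = Setoid.reflexive (Word (Vᵒ B)) (≡.sym (PV.map-π₂-zipWord _))

    graphP : Hypergraph
    graphP = record { E = PE.setoid ; V = PV.setoid ; s = zippedWord sources ; t = zippedWord targets }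

    π₁ᴴ : HypMor graphP (graph A)
    π₁ᴴ = record { h = PE.π₁ ; k = PV.π₁ ; s-comm = π₁-word sources ; t-comm = π₁-word targets }

    π₂ᴴ : HypMor graphP (graph B)
    π₂ᴴ = record { h = PE.π₂ ; k = PV.π₂ ; s-comm = π₂-word sources ; t-comm = π₂-word targets }

    P : Obj
    P = record { graph = graphP ; π = π A ∘Hyp π₁ᴴ }

    π₁ : Hom P A
    π₁ = mkHom π₁ᴴ (λ _ → refl)

    π₂ : Hom P B
    π₂ = mkHom π₂ᴴ (λ (a , b , r) →
           ≡.trans (≡.sym (proj₁ (over g) b)) (≡.trans (≡.sym (cong (h (π C)) r)) (proj₁ (over f) a)))

    isPullback : IsPullback (HypΣ S) π₁ π₂ f g
    isPullback = componentwise⇒isPullback π₁ π₂ f g PE.isSetoidPullback PV.isSetoidPullback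

  isPullback⇒componentwise : ∀ {P A B C} (p₁ : Hom P A) (p₂ : Hom P B) (f : Hom A C) (g : Hom B C) →
    IsPullback (HypΣ S) p₁ p₂ f g → ComponentwisePullback p₁ p₂ f g
  isPullback⇒componentwise p₁ p₂ f g pb@(commute , universal) =
    let (u , p₁∘u≈π₁ , p₂∘u≈π₂ , _) = universal Z.π₁ Z.π₂ (proj₁ Z.isPullback)
        (v , π₁∘v≈p₁ , π₂∘v≈p₂ , _) = proj₂ Z.isPullback p₁ p₂ commute
        u∘v≈id = pullback-endo≈id p₁ p₂ f g pb (u ∘ v) (paste-≈ʳ p₁ u v Z.π₁ p₁ p₁∘u≈π₁ π₁∘v≈p₁)
                                                       (paste-≈ʳ p₂ u v Z.π₂ p₂ p₂∘u≈π₂ π₂∘v≈p₂)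
    in isSetoidPullback-retract Z.PE.isSetoidPullback (hᵐ u) (hᵐ v)
         (proj₁ p₁∘u≈π₁) (proj₁ p₂∘u≈π₂) (proj₁ π₁∘v≈p₁) (proj₁ π₂∘v≈p₂) (proj₁ u∘v≈id) ,
       isSetoidPullback-retract Z.PV.isSetoidPullback (kᵐ u) (kᵐ v)
         (proj₂ p₁∘u≈π₁) (proj₂ p₂∘u≈π₂) (proj₂ π₁∘v≈p₁) (proj₂ π₂∘v≈p₂) (proj₂ u∘v≈id)
    where module Z = CanonicalPullback f g

  mono⇔injective : ∀ {A B} (f : Hom A B) → Mono (HypΣ S) f ⇔ ComponentwiseInjective f
  mono⇔injective f = mk⇔ mono⇒injective injective⇒mono
    where
    module Kernel = CanonicalPullback f f

    mono⇒injective : Mono (HypΣ S) f → ComponentwiseInjective f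
    mono⇒injective mono = (λ {x} {y} e → proj₁ π₁≈π₂ (x , y , e)) , (λ {x} {y} e → proj₂ π₁≈π₂ (x , y , e))
      where
      π₁≈π₂ : Kernel.π₁ ≈ Kernel.π₂
      π₁≈π₂ = mono Kernel.π₁ Kernel.π₂ (proj₁ Kernel.isPullback)

    injective⇒mono : ComponentwiseInjective f → Mono (HypΣ S) f
    injective⇒mono (injective-edges , injective-nodes) _ _ (fg₁≈fg₂ᴱ , fg₁≈fg₂ⱽ) =
      (λ x → injective-edges (fg₁≈fg₂ᴱ x)) , (λ v → injective-nodes (fg₁≈fg₂ⱽ v))

  module _ {A B C D : Obj} (i₁ : Hom A D) (i₂ : Hom B D) (m : Hom C A) (f : Hom C B)
           (edges : IsSetoidPushout (hᵐ i₁) (hᵐ i₂) (hᵐ m) (hᵐ f))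
           (nodes : IsSetoidPushout (kᵐ i₁) (kᵐ i₂) (kᵐ m) (kᵐ f)) where
    private
      module Copair {X} (j₁ : Hom A X) (j₂ : Hom B X) (j-commute : j₁ ∘ m ≈ j₂ ∘ f) where
        module CE = Copairing edges (hᵐ j₁) (hᵐ j₂) (proj₁ j-commute)
        module CV = Copairing nodes (kᵐ j₁) (kᵐ j₂) (proj₂ j-commute)

        u : Hom D X
        u = mkHom (mkHypMor CE.copair CV.copair λ σ x →
                     [ word-comm-on-image σ (mor i₁) (mor j₁) CE.copair CV.copair CE.copair-i₁ CV.copair-i₁
                     , word-comm-on-image σ (mor i₂) (mor j₂) CE.copair CV.copair CE.copair-i₂ CV.copair-i₂
                     ]′ (IsSetoidPushout.jointly-surjective edges x))
                  (λ x → [ label-on-image i₁ j₁ CE.copair CE.copair-i₁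
                         , label-on-image i₂ j₂ CE.copair CE.copair-i₂
                         ]′ (IsSetoidPushout.jointly-surjective edges x))

        u∘i₁≈j₁ : u ∘ i₁ ≈ j₁
        u∘i₁≈j₁ = CE.copair-i₁ , CV.copair-i₁

        u∘i₂≈j₂ : u ∘ i₂ ≈ j₂
        u∘i₂≈j₂ = CE.copair-i₂ , CV.copair-i₂

        unique : ∀ u' → u' ∘ i₁ ≈ j₁ → u' ∘ i₂ ≈ j₂ → u' ≈ u
        unique u' (u'₁ᴱ , u'₁ⱽ) (u'₂ᴱ , u'₂ⱽ) =
          CE.copair-unique (hᵐ u') u'₁ᴱ u'₂ᴱ , CV.copair-unique (kᵐ u') u'₁ⱽ u'₂ⱽ

    componentwise⇒isPushout : IsPushout (HypΣ S) i₁ i₂ m f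
    componentwise⇒isPushout =
      (IsSetoidPushout.commute edges , IsSetoidPushout.commute nodes) ,
      λ j₁ j₂ j-commute → let open Copair j₁ j₂ j-commute in u , u∘i₁≈j₁ , u∘i₂≈j₂ , unique

  module CanonicalPushout {A B C : Obj} (m : Hom C A) (f : Hom C B)
           (m-injective : ComponentwiseInjective m) where
    module DE = SetoidPushout (hᵐ m) (hᵐ f) (proj₁ m-injective)
    module DV = SetoidPushout (kᵐ m) (kᵐ f) (proj₂ m-injective)

    private
      module WD = Setoid (Word DV.setoid)

      tag : Attachment → Carrier DE.setoid → List (Carrier DV.setoid)
      tag σ (inj₁ a) = map inj₁ (word σ (graph A) ∙ a)
      tag σ (inj₂ b) = map inj₂ (word σ (graph B) ∙ b)

      glued-words : (σ : Attachment) → ∀ {a b} → DE.Glued a b → tag σ (inj₁ a) ≈[ Word DV.setoid ] tag σ (inj₂ b)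
      glued-words σ {a} {b} (c , mc≈a , fc≈b) = begin
        map inj₁ (word σ (graph A) ∙ a)                   ≈⟨ cong (wordMap DV.ι₁) (cong (word σ (graph A)) mc≈a) ⟨
        map inj₁ (word σ (graph A) ∙ hᵐ m ∙ c)            ≈⟨ cong (wordMap DV.ι₁) (word-comm σ (mor m) c) ⟩
        map inj₁ (map (to (kᵐ m)) (word σ (graph C) ∙ c)) ≈⟨ PW.map⁺ inj₁ inj₂ (PW.map⁺ (to (kᵐ m)) (to (kᵐ f))
                                                               (PW.refl (IsSetoidPushout.commute DV.isSetoidPushout _))) ⟩
        map inj₂ (map (to (kᵐ f)) (word σ (graph C) ∙ c)) ≈⟨ cong (wordMap DV.ι₂) (word-comm σ (mor f) c) ⟨
        map inj₂ (word σ (graph B) ∙ hᵐ f ∙ c)            ≈⟨ cong (wordMap DV.ι₂) (cong (word σ (graph B)) fc≈b) ⟩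
        map inj₂ (word σ (graph B) ∙ b)                   ∎
        where open ≈-Reasoning (Word DV.setoid)

      tag-cong : (σ : Attachment) → ∀ {x y} → x DE.~ y → tag σ x ≈[ Word DV.setoid ] tag σ y
      tag-cong σ {inj₁ _} {inj₁ _} (inj₁ e) = cong (wordMap DV.ι₁) (cong (word σ (graph A)) e)
      tag-cong σ {inj₁ _} {inj₁ _} (inj₂ (c , c' , mc≈a , mc'≈a' , fc≈fc')) =
        WD.trans (glued-words σ (c , mc≈a , Setoid.refl (Eᵒ B)))
          (WD.trans (cong (wordMap DV.ι₂) (cong (word σ (graph B)) fc≈fc'))
            (WD.sym (glued-words σ (c' , mc'≈a' , Setoid.refl (Eᵒ B)))))
      tag-cong σ {inj₁ _} {inj₂ _} e = glued-words σ e
      tag-cong σ {inj₂ _} {inj₁ _} e = WD.sym (glued-words σ e)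
      tag-cong σ {inj₂ _} {inj₂ _} e = cong (wordMap DV.ι₂) (cong (word σ (graph B)) e)

      taggedWord : Attachment → Func DE.setoid (Word DV.setoid)
      taggedWord σ = record { to = tag σ ; cong = λ {x} {y} → tag-cong σ {x} {y} }

    graphD : Hypergraph
    graphD = record { E = DE.setoid ; V = DV.setoid ; s = taggedWord sources ; t = taggedWord targets }

    private
      labelD : Carrier DE.setoid → O S
      labelD (inj₁ a) = label A a
      labelD (inj₂ b) = label B b

      glued-labels : ∀ {a b} → DE.Glued a b → label A a ≡ label B b
      glued-labels (c , mc≈a , fc≈b) =
        ≡.trans (≡.sym (cong (h (π A)) mc≈a))
          (≡.trans (proj₁ (over m) c) (≡.trans (≡.sym (proj₁ (over f) c)) (cong (h (π B)) fc≈b)))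

      labelD-cong : ∀ {x y} → x DE.~ y → labelD x ≡ labelD y
      labelD-cong {inj₁ _} {inj₁ _} (inj₁ e) = cong (h (π A)) e
      labelD-cong {inj₁ _} {inj₁ _} (inj₂ (c , c' , mc≈a , mc'≈a' , fc≈fc')) =
        ≡.trans (glued-labels (c , mc≈a , Setoid.refl (Eᵒ B)))
          (≡.trans (cong (h (π B)) fc≈fc') (≡.sym (glued-labels (c' , mc'≈a' , Setoid.refl (Eᵒ B)))))
      labelD-cong {inj₁ _} {inj₂ _} e = glued-labels e
      labelD-cong {inj₂ _} {inj₁ _} e = ≡.sym (glued-labels e)
      labelD-cong {inj₂ _} {inj₂ _} e = cong (h (π B)) e

      labelD-word : (σ : Attachment) → ∀ x →
        word σ (𝒢 S) ∙ labelD x ≈[ Word (V (𝒢 S)) ] map (λ _ → tt) (tag σ x)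
      labelD-word σ (inj₁ a) = Setoid.trans (Word (V (𝒢 S))) (word-comm σ (π A) a)
        (pointwise-map-map (to (k (π A))) (λ _ → tt) inj₁ (λ _ → refl) _)
      labelD-word σ (inj₂ b) = Setoid.trans (Word (V (𝒢 S))) (word-comm σ (π B) b)
        (pointwise-map-map (to (k (π B))) (λ _ → tt) inj₂ (λ _ → refl) _)

      πD : HypMor graphD (𝒢 S)
      πD = record
        { h = record { to = labelD ; cong = λ {x} {y} → labelD-cong {x} {y} }
        ; k = record { to = λ _ → tt ; cong = λ _ → refl }
        ; s-comm = labelD-word sources
        ; t-comm = labelD-word targets
        }

    D : Obj
    D = record { graph = graphD ; π = πD }

    ι₁ : Hom A D
    ι₁ = mkHom (record { h = DE.ι₁ ; k = DV.ι₁ ; s-comm = λ _ → WD.refl ; t-comm = λ _ → WD.refl })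
               (λ _ → refl)

    ι₂ : Hom B D
    ι₂ = mkHom (record { h = DE.ι₂ ; k = DV.ι₂ ; s-comm = λ _ → WD.refl ; t-comm = λ _ → WD.refl })
               (λ _ → refl)

    isPushout : IsPushout (HypΣ S) ι₁ ι₂ m f
    isPushout = componentwise⇒isPushout ι₁ ι₂ m f DE.isSetoidPushout DV.isSetoidPushout

  isPushout⇒componentwise : ∀ {A B C D} (i₁ : Hom A D) (i₂ : Hom B D) (m : Hom C A) (f : Hom C B) →
    ComponentwiseInjective m → IsPushout (HypΣ S) i₁ i₂ m f → ComponentwisePushout i₁ i₂ m f
  isPushout⇒componentwise i₁ i₂ m f m-injective po@(commute , universal) =
    let (u , u∘i₁≈ι₁ , u∘i₂≈ι₂ , _) = universal Z.ι₁ Z.ι₂ (proj₁ Z.isPushout)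
        (v , v∘ι₁≈i₁ , v∘ι₂≈i₂ , _) = proj₂ Z.isPushout i₁ i₂ commute
        v∘u≈id = pushout-endo≈id i₁ i₂ m f po (v ∘ u) (paste-≈ˡ v u i₁ Z.ι₁ i₁ u∘i₁≈ι₁ v∘ι₁≈i₁)
                                                      (paste-≈ˡ v u i₂ Z.ι₂ i₂ u∘i₂≈ι₂ v∘ι₂≈i₂)
    in isSetoidPushout-retract Z.DE.isSetoidPushout (hᵐ u) (hᵐ v)
         (proj₁ u∘i₁≈ι₁) (proj₁ u∘i₂≈ι₂) (proj₁ v∘ι₁≈i₁) (proj₁ v∘ι₂≈i₂) (proj₁ v∘u≈id) ,
       isSetoidPushout-retract Z.DV.isSetoidPushout (kᵐ u) (kᵐ v)
         (proj₂ u∘i₁≈ι₁) (proj₂ u∘i₂≈ι₂) (proj₂ v∘ι₁≈i₁) (proj₂ v∘ι₂≈i₂) (proj₂ v∘u≈id)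
    where module Z = CanonicalPushout m f m-injective

  pushout-along-mono-isVanKampen : ∀ {A B C D} (m : Hom C A) (f : Hom C B) (i₁ : Hom A D) (i₂ : Hom B D) →
    Mono (HypΣ S) m → IsPushout (HypΣ S) i₁ i₂ m f → IsVanKampen (HypΣ S) i₁ i₂ m f
  pushout-along-mono-isVanKampen m f i₁ i₂ mono bottom m' f' i₁' i₂' a b c d
      (top-commuteᴱ , top-commuteⱽ) (front-Aᴱ , front-Aⱽ) (front-Bᴱ , front-Bⱽ) back-A back-B =
    mk⇔ top⇒fronts fronts⇒top
    where
    m-injective : ComponentwiseInjective m
    m-injective = Equivalence.to (mono⇔injective m) mono

    bottom-components : ComponentwisePushout i₁ i₂ m f
    bottom-components = isPushout⇒componentwise i₁ i₂ m f m-injective bottom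

    back-A-components : ComponentwisePullback m' c a m
    back-A-components = isPullback⇒componentwise m' c a m back-A

    back-B-components : ComponentwisePullback f' c b f
    back-B-components = isPullback⇒componentwise f' c b f back-B

    module VKᴱ = SetoidVanKampen (hᵐ m) (hᵐ f) (hᵐ i₁) (hᵐ i₂) (hᵐ m') (hᵐ f') (hᵐ i₁') (hᵐ i₂')
                                 (hᵐ a) (hᵐ b) (hᵐ c) (hᵐ d) (proj₁ m-injective) (proj₁ bottom-components)
                                 top-commuteᴱ front-Aᴱ front-Bᴱ (proj₁ back-A-components) (proj₁ back-B-components)
    module VKⱽ = SetoidVanKampen (kᵐ m) (kᵐ f) (kᵐ i₁) (kᵐ i₂) (kᵐ m') (kᵐ f') (kᵐ i₁') (kᵐ i₂')
                                 (kᵐ a) (kᵐ b) (kᵐ c) (kᵐ d) (proj₂ m-injective) (proj₂ bottom-components)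
                                 top-commuteⱽ front-Aⱽ front-Bⱽ (proj₂ back-A-components) (proj₂ back-B-components)

    top⇒fronts : IsPushout (HypΣ S) i₁' i₂' m' f' →
                 IsPullback (HypΣ S) i₁' a d i₁ × IsPullback (HypΣ S) i₂' b d i₂
    top⇒fronts top =
      let m'-injectiveᴱ = pullback-preserves-injective (proj₁ back-A-components) (proj₁ m-injective)
          m'-injectiveⱽ = pullback-preserves-injective (proj₂ back-A-components) (proj₂ m-injective)
          (topᴱ , topⱽ) = isPushout⇒componentwise i₁' i₂' m' f' (m'-injectiveᴱ , m'-injectiveⱽ) top
          (front-A-pbᴱ , front-B-pbᴱ) = VKᴱ.top-pushout⇒front-pullbacks topᴱ
          (front-A-pbⱽ , front-B-pbⱽ) = VKⱽ.top-pushout⇒front-pullbacks topⱽ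
      in componentwise⇒isPullback i₁' a d i₁ front-A-pbᴱ front-A-pbⱽ ,
         componentwise⇒isPullback i₂' b d i₂ front-B-pbᴱ front-B-pbⱽ

    fronts⇒top : IsPullback (HypΣ S) i₁' a d i₁ × IsPullback (HypΣ S) i₂' b d i₂ →
                 IsPushout (HypΣ S) i₁' i₂' m' f'
    fronts⇒top (front-A , front-B) =
      let (front-A-pbᴱ , front-A-pbⱽ) = isPullback⇒componentwise i₁' a d i₁ front-A
          (front-B-pbᴱ , front-B-pbⱽ) = isPullback⇒componentwise i₂' b d i₂ front-B
      in componentwise⇒isPushout i₁' i₂' m' f'
           (VKᴱ.front-pullbacks⇒top-pushout (front-A-pbᴱ , front-B-pbᴱ))
           (VKⱽ.front-pullbacks⇒top-pushout (front-A-pbⱽ , front-B-pbⱽ))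

  adhesive : Adhesive (HypΣ S)
  adhesive = record
    { pullback-along-mono = λ f g _ → let open CanonicalPullback f g in P , π₁ , π₂ , isPullback
    ; pushout-along-mono  = λ m f mono →
        let open CanonicalPushout m f (Equivalence.to (mono⇔injective m) mono)
        in D , ι₁ , ι₂ , isPushout
    ; pushout-along-mono-isVanKampen = pushout-along-mono-isVanKampen
    }

proposition4p11 : (S : Signature) →
    Adhesive (HypΣ S) ×
    (∀ {A B : HypΣObj S} (f : HypΣMor A B) →
      Mono (HypΣ S) f ⇔
        (Injective (Setoid._≈_ (E (graph A))) (Setoid._≈_ (E (graph B))) (Func.to (h (mor f))) ×
         Injective (Setoid._≈_ (V (graph A))) (Setoid._≈_ (V (graph B))) (Func.to (k (mor f)))))
proposition4p11 S = adhesive , mono⇔injective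
  where open HypΣProperties S
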